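{- Let $A$ and $B$ be sets. Let $E_{AB}=\mathbf{Top}(A^{\mathbb{N}},B^{\mathbb{N}})$ be the set of continuous functions $A^{\mathbb{N}}\to B^{\mathbb{N}}$, made into an $A$-ary magma by $\mathsf{split}$, and equipped with the magma homomorphism $\delta\colon E_{AB}\to B\cdot E_{AB}$ given as the composite of postcomposition with the homeomorphism $h\colon B^{\mathbb{N}}\to B\cdot B^{\mathbb{N}}$, $h(\vec b)=(b_0,\partial\vec b)$, followed by the inverse of the canonical comparison isomorphism $B\cdot\mathbf{Top}(A^{\mathbb{N}},B^{\mathbb{N}})\to\mathbf{Top}(A^{\mathbb{N}},B\cdot B^{\mathbb{N}})$. Then $(E_{AB},\mathsf{split},\delta)$ is a final $\mathbb{T}_A$-$\mathbb{T}_B$-bimodel. In particular, the set of continuous functions $A^{\mathbb{N}}\to B^{\mathbb{N}}$ is the underlying set of the terminal $B$-ary comagma in the category of $A$-ary magmas.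
   Context: An $A$-ary magma is a set $X$ with a function $\xi\colon X^A\to X$ (no axioms); homomorphisms commute with these operations. The category of $A$-ary magmas has all coproducts; $B\cdot\mathcal{X}$ denotes the coproduct of $B$ copies of $\mathcal{X}$. A $\mathbb{T}_A$-$\mathbb{T}_B$-bimodel (equivalently, a $B$-ary comagma in the category of $A$-ary magmas) is an $A$-ary magma $\mathcal{K}$ with a magma homomorphism $\delta\colon\mathcal{K}\to B\cdot\mathcal{K}$; a map of bimodels $(\mathcal{K},\delta)\to(\mathcal{K}',\delta')$ is a magma homomorphism $f$ with $\delta'\circ f=(B\cdot f)\circ\delta$; final means terminal in this category. $A^{\mathbb{N}}$, $B^{\mathbb{N}}$ carry the product of discrete topologies; $\partial$ is the shift $(x_0,x_1,\dots)\mapsto(x_1,x_2,\dots)$; $B\cdot B^{\mathbb{N}}$ is the topological coproduct $B\times B^{\mathbb{N}}$ with $B$ discrete. For a space $C$, $\mathbf{Top}(A^{\mathbb{N}},C)$ is an $A$-ary magma via $\mathsf{split}(\vec f)(\vec a)=f_{a_0}(\partial\vec a)$. The canonical comparison map $B\cdot\mathbf{Top}(A^{\mathbb{N}},B^{\mathbb{N}})\to\mathbf{Top}(A^{\mathbb{N}},B\cdot B^{\mathbb{N}})$ is the magma homomorphism whose $b$-th component is $f\mapsto\iota_b\circ f$ ($\iota_b$ the $b$-th coproduct injection of spaces); it is an isomorphism of magmas. -}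

module Defs where

open import Level using (0ℓ)
open import Data.Nat using (ℕ; zero; suc; _<_; s≤s; z≤n)
open import Data.Product using (Σ; _×_; _,_; proj₁; proj₂)
open import Function using (_∘_)
open import Relation.Binary using (Rel; IsEquivalence)
open import Relation.Binary.PropositionalEquality using (_≡_; refl; subst)

Stream : Set → Set
Stream A = ℕ → A

tail : ∀ {A : Set} → Stream A → Stream A
tail x n = x (suc n)

Agree : ∀ {A : Set} → ℕ → Stream A → Stream A → Set
Agree n x y = ∀ i → i < n → x i ≡ y i

-- Continuity for the product of discrete topologies, unfolded through
-- the basis of cylinder sets: every output prefix depends on finitely
-- many input coordinates (pointwise).
Continuous : ∀ {A B : Set} → (Stream A → Stream B) → Set
Continuous f = ∀ x n → Σ ℕ λ m → ∀ y → Agree m x y → Agree n (f x) (f y)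

record Magma (A : Set) : Set₁ where
  field
    Carrier       : Set
    _≈_           : Rel Carrier 0ℓ
    isEquivalence : IsEquivalence _≈_
    op            : (A → Carrier) → Carrier
    op-cong       : ∀ {xs ys : A → Carrier} → (∀ a → xs a ≈ ys a) → op xs ≈ op ys

open Magma public using (Carrier)

record IsHom {A : Set} (M N : Magma A) (f : Carrier M → Carrier N) : Set where
  private
    module M = Magma M
    module N = Magma N
  field
    f-cong : ∀ {x y} → x M.≈ y → f x N.≈ f y
    f-hom  : ∀ (xs : A → M.Carrier) → f (M.op xs) N.≈ N.op (f ∘ xs)

-- The coproduct B · M of B copies of an A-ary magma M:
-- free A-ary terms over B × Carrier M, modulo the congruence making each
-- injection  leaf b  a (well-defined) magma homomorphism.

data Tm {A : Set} (B : Set) (M : Magma A) : Set where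
  leaf : B → Carrier M → Tm B M
  node : (A → Tm B M) → Tm B M

data _∼_ {A : Set} {B : Set} {M : Magma A} : Tm B M → Tm B M → Set where
  ∼-refl    : ∀ {t} → t ∼ t
  ∼-sym     : ∀ {t u} → t ∼ u → u ∼ t
  ∼-trans   : ∀ {t u v} → t ∼ u → u ∼ v → t ∼ v
  leaf-cong : ∀ b {k k'} → Magma._≈_ M k k' → leaf b k ∼ leaf b k'
  node-cong : ∀ {ts us : A → Tm B M} → (∀ a → ts a ∼ us a) → node ts ∼ node us
  leaf-op   : ∀ b (ks : A → Carrier M) →
              leaf b (Magma.op M ks) ∼ node (λ a → leaf b (ks a))

infix 4 _∼_

_·_ : {A : Set} → Set → Magma A → Magma A
B · M = record
  { Carrier = Tm B M
  ; _≈_ = _∼_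
  ; isEquivalence = record { refl = ∼-refl ; sym = ∼-sym ; trans = ∼-trans }
  ; op = node
  ; op-cong = node-cong
  }

map· : {A B : Set} {M N : Magma A} → (Carrier M → Carrier N) → Tm B M → Tm B N
map· f (leaf b k) = leaf b (f k)
map· f (node ts)  = node (λ a → map· f (ts a))

record Bimodel (A B : Set) : Set₁ where
  field
    magma : Magma A
    δ     : Carrier magma → Tm B magma
    δ-hom : IsHom magma (B · magma) δ

IsBimodelMap : {A B : Set} (K K' : Bimodel A B) →
               (Carrier (Bimodel.magma K) → Carrier (Bimodel.magma K')) → Set
IsBimodelMap {A} {B} K K' f =
  IsHom (Bimodel.magma K) (Bimodel.magma K') f ×
  (∀ k → Bimodel.δ K' (f k) ∼ map· f (Bimodel.δ K k))

-- terminal object in the category of bimodels (equality of maps is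
-- pointwise setoid equality in the target)
IsFinal : {A B : Set} → Bimodel A B → Set₁
IsFinal {A} {B} E =
  ∀ (K : Bimodel A B) →
    Σ (Carrier (Bimodel.magma K) → Carrier (Bimodel.magma E)) λ f →
      IsBimodelMap K E f ×
      (∀ g → IsBimodelMap K E g →
         ∀ k → Magma._≈_ (Bimodel.magma E) (g k) (f k))

Top : (A B : Set) → Set
Top A B = Σ (Stream A → Stream B) Continuous

_≈Top_ : ∀ {A B} → Top A B → Top A B → Set
f ≈Top g = ∀ x n → proj₁ f x n ≡ proj₁ g x n

private
  split-cont : ∀ {A B : Set} (fs : A → Top A B) →
               Continuous (λ x → proj₁ (fs (x 0)) (tail x))
  split-cont {A} {B} fs x n with proj₂ (fs (x 0)) (tail x) n
  ... | m , h = suc m , λ y agr → go y agr (agr 0 (s≤s z≤n))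
    where
      go : ∀ y → Agree (suc m) x y → x 0 ≡ y 0 →
           Agree n (proj₁ (fs (x 0)) (tail x)) (proj₁ (fs (y 0)) (tail y))
      go y agr eq rewrite Relation.Binary.PropositionalEquality.sym eq =
        h (tail y) (λ i i<m → agr (suc i) (s≤s i<m))

split : ∀ {A B : Set} → (A → Top A B) → Top A B
split fs = (λ x → proj₁ (fs (x 0)) (tail x)) , split-cont fs

E : (A B : Set) → Magma A
E A B = record
  { Carrier = Top A B
  ; _≈_ = _≈Top_
  ; isEquivalence = record
      { refl = λ x n → refl
      ; sym = λ p x n → Relation.Binary.PropositionalEquality.sym (p x n)
      ; trans = λ p q x n → Relation.Binary.PropositionalEquality.trans (p x n) (q x n) }
  ; op = split
  ; op-cong = λ p x n → p (x 0) (tail x) n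
  }

-- B · B^ℕ = B × B^ℕ, and h(b⃗) = (b₀, ∂b⃗)
h : ∀ {B : Set} → Stream B → B × Stream B
h b = b 0 , tail b

-- the canonical comparison map  B · Top(A^ℕ,B^ℕ) → Top(A^ℕ, B · B^ℕ):
-- the unique magma map whose b-th component is f ↦ ι_b ∘ f
comparison : ∀ {A B : Set} → Tm B (E A B) → Stream A → B × Stream B
comparison (leaf b f) x = b , proj₁ f x
comparison (node ts) x  = comparison (ts (x 0)) (tail x)

-- δ is the inverse of the comparison iso composed with postcomposition by h,
-- i.e. comparison ∘ δ = h ∘ (-)  (pointwise equality in B × B^ℕ)
IsDeltaE : ∀ {A B : Set} → (Top A B → Tm B (E A B)) → Set
IsDeltaE {A} {B} δ = ∀ (f : Top A B) (x : Stream A) →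
  (proj₁ (comparison (δ f) x) ≡ proj₁ (h (proj₁ f x))) ×
  (∀ n → proj₂ (comparison (δ f) x) n ≡ proj₂ (h (proj₁ f x)) n)

EBimodel : (A B : Set) (δ : Top A B → Tm B (E A B)) → IsHom (E A B) (B · E A B) δ →
           Bimodel A B
EBimodel A B δ δh = record { magma = E A B ; δ = δ ; δ-hom = δh }

{-# OPTIONS --safe #-}
module Submission where

-- A bimodel K is a transducer: δ k is a finite A-branching tree whose
-- leaves carry an output letter and a next state, and input letters select
-- the path through it.  Running K on an input stream gives each state a
-- behaviour A^ℕ → B^ℕ whose n-th output reads only finitely many inputs;
-- this is the unique map into E_AB commuting with the comaps.  Uniqueness
-- and the commutation both rest on the comparison map being injective up
-- to ∼: every continuous f is the split of its one-letter shifts, so terms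
-- with the same comparison can be unfolded to the same tree shape.

open import Defs
open import Data.Nat using (ℕ; zero; suc; _≤_; s≤s; z≤n)
open import Data.Nat.Properties using (n≤1+n; n<1+n; <-≤-trans)
open import Data.Product using (Σ; _×_; _,_; proj₁; proj₂)
open import Data.Product.Relation.Binary.Pointwise.NonDependent using (Pointwise)
open import Relation.Binary.PropositionalEquality
  using (_≡_; _≗_; refl; sym; trans; subst)

private
  variable
    A B : Set
    m n : ℕ
    x y : Stream A

cons : A → Stream A → Stream A
cons a x zero    = a
cons a x (suc n) = x n

cons-head-tail : (x : Stream A) → x ≗ cons (x 0) (tail x)
cons-head-tail x zero    = refl
cons-head-tail x (suc n) = refl

Agree-mono : m ≤ n → Agree n x y → Agree m x y
Agree-mono m≤n agr i i<m = agr i (<-≤-trans i<m m≤n)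

Agree-tail : Agree (suc m) x y → Agree m (tail x) (tail y)
Agree-tail agr i i<m = agr (suc i) (s≤s i<m)

Agree-suc : x 0 ≡ y 0 → Agree n (tail x) (tail y) → Agree (suc n) x y
Agree-suc head≡ agr zero    _         = head≡
Agree-suc head≡ agr (suc i) (s≤s i<n) = agr i i<n

ContinuousAt : (Stream A → Stream B) → Stream A → ℕ → Set
ContinuousAt f x n = Σ ℕ λ m → ∀ y → Agree m x y → Agree n (f x) (f y)

split-continuousAt : (F : A → Stream A → Stream B) →
                     ContinuousAt (F (x 0)) (tail x) n →
                     ContinuousAt (λ z → F (z 0) (tail z)) x n
split-continuousAt {x = x} {n = n} F (m , agree) = suc m , λ y agr →
  subst (λ a → Agree n (F (x 0) (tail x)) (F a (tail y)))
        (agr 0 (s≤s z≤n)) (agree (tail y) (Agree-tail agr))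

-- Without function extensionality, invariance under ≗ has to come from continuity.
continuous-resp-≗ : (f : Top A B) → x ≗ y → proj₁ f x ≗ proj₁ f y
continuous-resp-≗ {x = x} (f , f-cont) x≗y n =
  let (m , agree) = f-cont x (suc n) in agree _ (λ i _ → x≗y i) n (n<1+n n)

shift : Top A B → A → Top A B
shift (f , f-cont) a = (λ x → f (cons a x)) , λ x n →
  let (m , agree) = f-cont (cons a x) n in
  m , λ y agr → agree (cons a y) (Agree-mono (n≤1+n m) (Agree-suc refl agr))

split-shift : (f : Top A B) → f ≈Top split (shift f)
split-shift f x = continuous-resp-≗ f (cons-head-tail x)

leaf-split : (b : B) (f : Top A B) →
             leaf {M = E A B} b f ∼ node (λ a → leaf b (shift f a))
leaf-split b f = ∼-trans (leaf-cong b (split-shift f)) (leaf-op b (shift f))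

leaf-≈ : {b b′ : B} {f g : Top A B} → b ≡ b′ → f ≈Top g → leaf {M = E A B} b f ∼ leaf b′ g
leaf-≈ {b = b} refl f≈g = leaf-cong b f≈g

_≋_ : B × Stream B → B × Stream B → Set
_≋_ = Pointwise _≡_ _≗_

≋-sym : {p q : B × Stream B} → p ≋ q → q ≋ p
≋-sym (b≡b′ , s≗s′) = sym b≡b′ , λ n → sym (s≗s′ n)

≋-trans : {p q r : B × Stream B} → p ≋ q → q ≋ r → p ≋ r
≋-trans (b≡b′ , s≗s′) (b′≡b″ , s′≗s″) = trans b≡b′ b′≡b″ , λ n → trans (s≗s′ n) (s′≗s″ n)

SameComparison : Tm B (E A B) → Tm B (E A B) → Set
SameComparison t u = ∀ x → comparison t x ≋ comparison u x

comparison-cong : {t u : Tm B (E A B)} → t ∼ u → SameComparison t u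
comparison-cong ∼-refl            x = refl , λ _ → refl
comparison-cong (∼-sym t∼u)       x = ≋-sym (comparison-cong t∼u x)
comparison-cong (∼-trans t∼u u∼v) x = ≋-trans (comparison-cong t∼u x) (comparison-cong u∼v x)
comparison-cong (leaf-cong b f≈g) x = refl , f≈g x
comparison-cong (node-cong ts∼us) x = comparison-cong (ts∼us (x 0)) (tail x)
comparison-cong (leaf-op b fs)    x = refl , λ _ → refl

leaf-determined : (b : B) (f : Top A B) (u : Tm B (E A B)) →
                  SameComparison (leaf b f) u → leaf b f ∼ u
leaf-determined b f (node us) same =
  ∼-trans (leaf-split b f)
          (node-cong λ a → leaf-determined b (shift f a) (us a) λ x → same (cons a x))
-- Both leaves are split first: the labels can then be compared on an input
-- beginning with a, which exists even when A is empty.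
leaf-determined b f (leaf b′ g) same =
  ∼-trans (leaf-split b f)
          (∼-trans (node-cong λ a → leaf-≈ (proj₁ (same λ _ → a)) λ x → proj₂ (same (cons a x)))
                   (∼-sym (leaf-split b′ g)))

comparison-injective : (t u : Tm B (E A B)) → SameComparison t u → t ∼ u
comparison-injective (leaf b f) u         same = leaf-determined b f u same
comparison-injective (node ts)  (leaf b g) same =
  ∼-sym (leaf-determined b g (node ts) λ x → ≋-sym (same x))
comparison-injective (node ts)  (node us) same =
  node-cong λ a → comparison-injective (ts a) (us a) λ x → same (cons a x)

module Behaviour (K : Bimodel A B) where
  open Bimodel K renaming (magma to M)
  open IsHom δ-hom renaming (f-cong to δ-cong; f-hom to δ-op)

  run : ℕ → Tm B M → Stream A → B
  run n       (node ts)  x = run n (ts (x 0)) (tail x)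
  run zero    (leaf b k) x = b
  run (suc n) (leaf b k) x = run n (δ k) x

  run-cong : ∀ n {t u} → t ∼ u → ∀ x → run n t x ≡ run n u x
  run-cong n       ∼-refl            x = refl
  run-cong n       (∼-sym t∼u)       x = sym (run-cong n t∼u x)
  run-cong n       (∼-trans t∼u u∼v) x = trans (run-cong n t∼u x) (run-cong n u∼v x)
  run-cong zero    (leaf-cong b k≈l) x = refl
  run-cong (suc n) (leaf-cong b k≈l) x = run-cong n (δ-cong k≈l) x
  run-cong n       (node-cong ts∼us) x = run-cong n (ts∼us (x 0)) (tail x)
  run-cong zero    (leaf-op b ks)    x = refl
  run-cong (suc n) (leaf-op b ks)    x = run-cong n (δ-op ks) x

  run-continuousAt : ∀ t x n → ContinuousAt (λ z i → run i t z) x n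
  run-continuousAt t          x zero    = 0 , λ _ _ _ ()
  run-continuousAt (leaf b k) x (suc n) =
    let (m , agree) = run-continuousAt (δ k) x n in
    m , λ y agr → Agree-suc refl (agree y agr)
  run-continuousAt (node ts)  x (suc n) =
    split-continuousAt (λ a z i → run i (ts a) z) (run-continuousAt (ts (x 0)) (tail x) (suc n))

  unfold : Carrier M → Top A B
  unfold k = (λ x i → run i (δ k) x) , run-continuousAt (δ k)

  unfold-isHom : IsHom M (E A B) unfold
  unfold-isHom = record
    { f-cong = λ k≈l x n → run-cong n (δ-cong k≈l) x
    ; f-hom  = λ ks x n → run-cong n (δ-op ks) x
    }

  comparison-map·-head : (g : Carrier M → Top A B) (t : Tm B M) (x : Stream A) →
                         proj₁ (comparison (map· g t) x) ≡ run 0 t x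
  comparison-map·-head g (leaf b k) x = refl
  comparison-map·-head g (node ts)  x = comparison-map·-head g (ts (x 0)) (tail x)

  comparison-map·-tail : (g : Carrier M → Top A B) (n : ℕ) →
                         (∀ k x → proj₁ (g k) x n ≡ run n (δ k) x) →
                         (t : Tm B M) (x : Stream A) →
                         proj₂ (comparison (map· g t) x) n ≡ run (suc n) t x
  comparison-map·-tail g n g≡run (leaf b k) x = g≡run k x
  comparison-map·-tail g n g≡run (node ts)  x = comparison-map·-tail g n g≡run (ts (x 0)) (tail x)

  IsBehaviour : (Carrier M → Top A B) → Set
  IsBehaviour g = ∀ k x → h (proj₁ (g k) x) ≋ comparison (map· g (δ k)) x

  unfold-isBehaviour : IsBehaviour unfold
  unfold-isBehaviour k x =
    ≋-sym (comparison-map·-head unfold (δ k) x ,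
           λ n → comparison-map·-tail unfold n (λ _ _ → refl) (δ k) x)

  unfold-unique : ∀ g → IsBehaviour g → ∀ k → g k ≈Top unfold k
  unfold-unique g behaves k x n = coordinate n k x
    where
    coordinate : ∀ n k x → proj₁ (g k) x n ≡ run n (δ k) x
    coordinate zero    k x = trans (proj₁ (behaves k x)) (comparison-map·-head g (δ k) x)
    coordinate (suc n) k x =
      trans (proj₂ (behaves k x) n) (comparison-map·-tail g n (coordinate n) (δ k) x)

theorem5p11 : (A B : Set) (δ : Top A B → Tm B (E A B)) (δh : IsHom (E A B) (B · E A B) δ) →
    IsDeltaE δ → IsFinal (EBimodel A B δ δh)
theorem5p11 A B δ δh δ-spec K = unfold , (unfold-isHom , unfold-commutes) , unique
  where
  open Behaviour K

  unfold-commutes : ∀ k → δ (unfold k) ∼ map· unfold (Bimodel.δ K k)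
  unfold-commutes k = comparison-injective _ _ λ x →
    ≋-trans (δ-spec (unfold k) x) (unfold-isBehaviour k x)

  unique : ∀ g → IsBimodelMap K (EBimodel A B δ δh) g → ∀ k → g k ≈Top unfold k
  unique g (_ , g-commutes) = unfold-unique g λ k x →
    ≋-trans (≋-sym (δ-spec (g k) x)) (comparison-cong (g-commutes k) x)
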